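{- Let $g\in\mathcal{E}$ with $g\neq\mathrm{id}_{\omega}$, and let $R$ be a binary relation on a discrete space $A$. Then $R$ is a $g$-better-relation if and only if $R$ is a better-relation. In particular, a quasi-order $(Q,\leq)$ (with $Q$ discrete) is $g$-bqo if and only if it is a better-quasi-order.
   Context: $\mathcal{E}$ is the set of strictly increasing maps $\omega\to\omega$, with the topology induced by the Baire space $\omega^{\omega}$. $[\omega]^{\omega}$ is the set of infinite subsets of $\omega$ with the topology induced from the Cantor space $2^{\omega}$. For a binary relation $R$ on $A$, $R^{\complement}=(A\times A)\setminus R$. $R$ is a better-relation on the discrete space $A$ if there is no continuous map $\varphi:[\omega]^{\omega}\to A$ such that for every $N\in[\omega]^{\omega}$, $\varphi(N)\,R^{\complement}\,\varphi(N\setminus\{\min N\})$. $R$ is a $g$-better-relation if there is no continuous map $\varphi:\mathcal{E}\to A$ such that $\varphi(f)\,R^{\complement}\,\varphi(f\circ g)$ for every $f\in\mathcal{E}$ (equivalently, for every continuous $\varphi:\mathcal{E}\to A$ there is $h\in\mathcal{E}$ with $\varphi(h\circ f)\,R\,\varphi(h\circ f\circ g)$ for all $f\in\mathcal{E}$). A quasi-order is $g$-bqo if it is a $g$-better-relation, and a better-quasi-order (bqo) if it is a better-relation (equivalently, there is no locally constant $h:[\omega]^{\omega}\to Q$ with $h(N)\not\leq h(N\setminus\{\min N\})$ for all $N$). -}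

module Defs where

open import Level using (Level; _⊔_)
open import Data.Nat using (ℕ; zero; suc; _≤_; _<_; s≤s; z≤n)
open import Data.Nat.Properties using (≤-trans; n≤1+n; m≤n⇒m<n∨m≡n)
open import Data.Bool using (Bool; true; false; _∧_; _∨_)
open import Data.Product using (Σ; ∃; _×_; _,_)
open import Data.Sum using (inj₁; inj₂)
open import Relation.Nullary using (¬_)
open import Relation.Binary.Core using (Rel)
open import Relation.Binary.PropositionalEquality using (_≡_; refl)

record ℰ : Set where
  constructor mkℰ
  field
    fun    : ℕ → ℕ
    strict : ∀ m n → m < n → fun m < fun n
open ℰ public

_∘ℰ_ : ℰ → ℰ → ℰ
f ∘ℰ g = mkℰ (λ n → fun f (fun g n))
             (λ m n m<n → strict f _ _ (strict g m n m<n))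

IsId : ℰ → Set
IsId g = ∀ n → fun g n ≡ n

Infinite : (ℕ → Bool) → Set
Infinite X = ∀ n → Σ ℕ λ m → n ≤ m × X m ≡ true

record InfSet : Set where
  constructor mkInf
  field
    char : ℕ → Bool
    inf  : Infinite char
open InfSet public

anyBefore : (ℕ → Bool) → ℕ → Bool
anyBefore X zero    = false
anyBefore X (suc i) = X i ∨ anyBefore X i

private
  ∨-trueʳ : ∀ b → b ∨ true ≡ true
  ∨-trueʳ false = refl
  ∨-trueʳ true  = refl

  anyBefore-true : ∀ X j i → X j ≡ true → j < i → anyBefore X i ≡ true
  anyBefore-true X j (suc i) Xj (s≤s j≤i) with m≤n⇒m<n∨m≡n j≤i
  ... | inj₁ j<i rewrite anyBefore-true X j i Xj j<i = ∨-trueʳ (X i)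
  ... | inj₂ refl rewrite Xj = refl

-- N \ {min N}: keep i ∈ N iff some element of N lies below i
dropMinChar : (ℕ → Bool) → ℕ → Bool
dropMinChar X i = X i ∧ anyBefore X i

dropMin : InfSet → InfSet
dropMin (mkInf X infX) = mkInf (dropMinChar X) inf'
  where
  inf' : Infinite (dropMinChar X)
  inf' n with infX n
  ... | m , n≤m , Xm with infX (suc m)
  ... | m' , sm≤m' , Xm' =
        m' , ≤-trans n≤m (≤-trans (n≤1+n m) sm≤m') , eq
    where
    eq : X m' ∧ anyBefore X m' ≡ true
    eq rewrite Xm' = anyBefore-true X m m' Xm sm≤m'

-- continuity into a discrete space A (= local constancy)
ContinuousInf : {a : Level} {A : Set a} → (InfSet → A) → Set a
ContinuousInf φ = ∀ X → Σ ℕ λ n → ∀ Y →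
  (∀ i → i < n → char X i ≡ char Y i) → φ X ≡ φ Y

Continuousℰ : {a : Level} {A : Set a} → (ℰ → A) → Set a
Continuousℰ φ = ∀ f → Σ ℕ λ n → ∀ f' →
  (∀ i → i < n → fun f i ≡ fun f' i) → φ f ≡ φ f'

BetterRelation : {a ℓ : Level} (A : Set a) → Rel A ℓ → Set (a ⊔ ℓ)
BetterRelation A R = ¬ (Σ (InfSet → A) λ φ → ContinuousInf φ ×
                          (∀ N → ¬ R (φ N) (φ (dropMin N))))

GBetterRelation : {a ℓ : Level} → ℰ → (A : Set a) → Rel A ℓ → Set (a ⊔ ℓ)
GBetterRelation g A R = ¬ (Σ (ℰ → A) λ φ → Continuousℰ φ ×
                             (∀ f → ¬ R (φ f) (φ (f ∘ℰ g))))

GBqo : {a ℓ : Level} → ℰ → (Q : Set a) → Rel Q ℓ → Set (a ⊔ ℓ)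
GBqo g Q _≤_ = GBetterRelation g Q _≤_

Bqo : {a ℓ : Level} (Q : Set a) → Rel Q ℓ → Set (a ⊔ ℓ)
Bqo Q _≤_ = BetterRelation Q _≤_

module Submission where

-- Let b be the least point moved by g: g fixes every p < b, and k ↦ g^k b is strictly
-- increasing. A bad map on [ω]^ω pulls back to a bad map on ℰ along f ↦ range (k ↦ f (g^k b)),
-- since replacing f by f ∘ g removes the minimum of that range. Conversely, a bad map on ℰ pulls
-- back along N ↦ G (e_N), where e_N enumerates N increasingly and G e fixes the points below b and
-- acts as g^(e i − i) on the block [g^i b, g^(i+1) b). Then G (e ∘ suc) = G e ∘ g and
-- e_(N ∖ {min N}) = e_N ∘ suc, and both maps are continuous.

open import Defs
open import Level using (Level; _⊔_)
open import Data.Bool using (Bool; true; false; _∧_; if_then_else_)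
open import Data.Bool.Properties using (∨-zeroʳ; ∧-conicalˡ; ∧-conicalʳ; ∧-identityʳ; ∧-zeroʳ; T-≡)
open import Data.Nat using (ℕ; zero; suc; _+_; _∸_; _≤_; _<_; z≤n; s≤s; _≡ᵇ_; _≟_; _≤?_; _<?_)
open import Data.Nat.GeneralisedArithmetic using (fold; fold-+)
open import Data.Nat.Properties
open import Data.Product using (Σ; ∃-syntax; _×_; _,_; proj₁; proj₂)
open import Data.Sum using (_⊎_; inj₁; inj₂)
open import Function.Base using (_∘_)
open import Function.Bundles using (_⇔_; mk⇔; Equivalence)
open import Relation.Binary.Core using (Rel)
open import Relation.Binary.Definitions using (tri<; tri≈; tri>)
open import Relation.Binary.PropositionalEquality
  using (_≡_; _≢_; _≗_; refl; sym; trans; cong; cong₂; subst; subst₂; module ≡-Reasoning)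
open import Relation.Binary.Structures using (IsPreorder)
open import Relation.Nullary using (¬_; yes; no; contradiction)
open import Relation.Nullary.Decidable using (decidable-stable)

n≤fun : (f : ℰ) → ∀ n → n ≤ fun f n
n≤fun f zero    = z≤n
n≤fun f (suc n) = ≤-trans (s≤s (n≤fun f n)) (strict f n (suc n) ≤-refl)

fun-mono-≤ : (f : ℰ) → ∀ {m n} → m ≤ n → fun f m ≤ fun f n
fun-mono-≤ f {m} {n} m≤n with m≤n⇒m<n∨m≡n m≤n
... | inj₁ m<n  = <⇒≤ (strict f m n m<n)
... | inj₂ refl = ≤-refl

fromSteps : (h : ℕ → ℕ) → (∀ p → h p < h (suc p)) → ℰ
fromSteps h step = mkℰ h increasing
  where
  increasing : ∀ m n → m < n → h m < h n
  increasing m (suc n) (s≤s m≤n) with m≤n⇒m<n∨m≡n m≤n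
  ... | inj₁ m<n  = <-trans (increasing m n m<n) (step n)
  ... | inj₂ refl = step m

shiftℰ : ℰ → ℰ
shiftℰ h = mkℰ (fun h ∘ suc) (λ m n m<n → strict h _ _ (s≤s m<n))

true⇔true⇒≡ : ∀ {x y : Bool} → (x ≡ true → y ≡ true) → (y ≡ true → x ≡ true) → x ≡ y
true⇔true⇒≡ {false} {false} _ _ = refl
true⇔true⇒≡ {false} {true}  _ h = h refl
true⇔true⇒≡ {true}  {false} h _ = sym (h refl)
true⇔true⇒≡ {true}  {true}  _ _ = refl

-- Bad maps and their transport along continuous maps

module _ {a ℓ : Level} (A : Set a) (R : Rel A ℓ) where

  BadInf : Set (a ⊔ ℓ)
  BadInf = Σ (InfSet → A) λ φ → ContinuousInf φ × (∀ N → ¬ R (φ N) (φ (dropMin N)))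

  Badℰ : ℰ → Set (a ⊔ ℓ)
  Badℰ g = Σ (ℰ → A) λ ψ → Continuousℰ ψ × (∀ f → ¬ R (ψ f) (ψ (f ∘ℰ g)))

ContinuousInf-resp : ∀ {a} {A : Set a} {φ : InfSet → A} → ContinuousInf φ →
                     ∀ {X Y} → char X ≗ char Y → φ X ≡ φ Y
ContinuousInf-resp cφ {X} {Y} X≗Y = proj₂ (cφ X) Y (λ i _ → X≗Y i)

Continuousℰ-resp : ∀ {a} {A : Set a} {ψ : ℰ → A} → Continuousℰ ψ →
                   ∀ {f f'} → fun f ≗ fun f' → ψ f ≡ ψ f'
Continuousℰ-resp cψ {f} {f'} f≗f' = proj₂ (cψ f) f' (λ i _ → f≗f' i)

Continuousℰ→Inf : (ℰ → InfSet) → Set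
Continuousℰ→Inf Φ = ∀ f n → ∃[ m ] ∀ f' → (∀ i → i < m → fun f i ≡ fun f' i) →
                      ∀ i → i < n → char (Φ f) i ≡ char (Φ f') i

ContinuousInf→ℰ : (InfSet → ℰ) → Set
ContinuousInf→ℰ Φ = ∀ N n → ∃[ m ] ∀ Y → (∀ i → i < m → char N i ≡ char Y i) →
                      ∀ i → i < n → fun (Φ N) i ≡ fun (Φ Y) i

module _ {a ℓ : Level} {A : Set a} {R : Rel A ℓ} (g : ℰ) where

  badInf⇒badℰ : (Φ : ℰ → InfSet) → Continuousℰ→Inf Φ →
                (∀ f → char (dropMin (Φ f)) ≗ char (Φ (f ∘ℰ g))) →
                BadInf A R → Badℰ A R g
  badInf⇒badℰ Φ cΦ Φ-g (φ , cφ , bad) = φ ∘ Φ , continuous , λ f → bad (Φ f) ∘ Φ-g-bad f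
    where
    continuous : Continuousℰ (φ ∘ Φ)
    continuous f =
      let (n , φ-agree) = cφ (Φ f); (m , Φ-agree) = cΦ f n
      in  m , λ f' f≈f' → φ-agree (Φ f') (Φ-agree f' f≈f')
    Φ-g-bad : ∀ f → R (φ (Φ f)) (φ (Φ (f ∘ℰ g))) → R (φ (Φ f)) (φ (dropMin (Φ f)))
    Φ-g-bad f = subst (R _) (sym (ContinuousInf-resp cφ (Φ-g f)))

  badℰ⇒badInf : (Φ : InfSet → ℰ) → ContinuousInf→ℰ Φ →
                (∀ N → fun (Φ N ∘ℰ g) ≗ fun (Φ (dropMin N))) →
                Badℰ A R g → BadInf A R
  badℰ⇒badInf Φ cΦ Φ-g (ψ , cψ , bad) = ψ ∘ Φ , continuous , λ N → bad (Φ N) ∘ Φ-g-bad N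
    where
    continuous : ContinuousInf (ψ ∘ Φ)
    continuous N =
      let (n , ψ-agree) = cψ (Φ N); (m , Φ-agree) = cΦ N n
      in  m , λ Y N≈Y → ψ-agree (Φ Y) (Φ-agree Y N≈Y)
    Φ-g-bad : ∀ N → R (ψ (Φ N)) (ψ (Φ (dropMin N))) → R (ψ (Φ N)) (ψ (Φ N ∘ℰ g))
    Φ-g-bad N = subst (R _) (sym (Continuousℰ-resp cψ (Φ-g N)))

anyBefore-sound : ∀ X n → anyBefore X n ≡ true → ∃[ j ] j < n × X j ≡ true
anyBefore-sound X (suc n) any with X n in Xn
... | true  = n , ≤-refl , Xn
... | false = let (j , j<n , Xj) = anyBefore-sound X n any in j , m<n⇒m<1+n j<n , Xj

anyBefore-complete : ∀ X {j} n → j < n → X j ≡ true → anyBefore X n ≡ true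
anyBefore-complete X {j} (suc n) (s≤s j≤n) Xj with m≤n⇒m<n∨m≡n j≤n
... | inj₁ j<n rewrite anyBefore-complete X n j<n Xj = ∨-zeroʳ (X n)
... | inj₂ refl rewrite Xj = refl

anyBefore-false : ∀ X n → (∀ j → j < n → X j ≡ false) → anyBefore X n ≡ false
anyBefore-false X zero    _       = refl
anyBefore-false X (suc n) none rewrite none n ≤-refl =
  anyBefore-false X n (λ j j<n → none j (m<n⇒m<1+n j<n))

-- Since k ≤ fun h k, a value i of h is attained at some k ≤ i: membership is a bounded search.
rangeChar : ℰ → ℕ → Bool
rangeChar h i = anyBefore (λ k → fun h k ≡ᵇ i) (suc i)

rangeChar-complete : ∀ h {k i} → fun h k ≡ i → rangeChar h i ≡ true
rangeChar-complete h {k} {i} hk≡i =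
  anyBefore-complete _ (suc i) (s≤s (subst (k ≤_) hk≡i (n≤fun h k)))
    (Equivalence.to T-≡ (≡⇒≡ᵇ _ _ hk≡i))

rangeChar-sound : ∀ h {i} → rangeChar h i ≡ true → ∃[ k ] fun h k ≡ i
rangeChar-sound h {i} hit =
  let (k , _ , hk≡ᵇi) = anyBefore-sound _ (suc i) hit
  in  k , ≡ᵇ⇒≡ _ _ (Equivalence.from T-≡ hk≡ᵇi)

range : ℰ → InfSet
range h = mkInf (rangeChar h) (λ n → fun h n , n≤fun h n , rangeChar-complete h refl)

dropMin-range : ∀ h → char (dropMin (range h)) ≗ rangeChar (shiftℰ h)
dropMin-range h i = true⇔true⇒≡ to from
  where
  to : dropMinChar (rangeChar h) i ≡ true → rangeChar (shiftℰ h) i ≡ true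
  to hit with rangeChar-sound h (∧-conicalˡ _ _ hit)
                | anyBefore-sound (rangeChar h) i (∧-conicalʳ _ _ hit)
  ... | suc k , hk≡i | _ = rangeChar-complete (shiftℰ h) hk≡i
  ... | zero  , h0≡i | j , j<i , j∈h =
    let (k , hk≡j) = rangeChar-sound h j∈h
    in  contradiction (fun-mono-≤ h (z≤n {k}))
          (<⇒≱ (subst₂ _<_ (sym hk≡j) (sym h0≡i) j<i))
  from : rangeChar (shiftℰ h) i ≡ true → dropMinChar (rangeChar h) i ≡ true
  from hit =
    let (k , hk≡i) = rangeChar-sound (shiftℰ h) hit
        h0<i = subst (fun h 0 <_) hk≡i (strict h 0 (suc k) (s≤s z≤n))
    in  cong₂ _∧_ (rangeChar-complete h hk≡i)
          (anyBefore-complete (rangeChar h) i h0<i (rangeChar-complete h refl))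

range-agree : ∀ h h' n → (∀ k → fun h k < n → fun h' k ≡ fun h k) →
              (∀ k → fun h' k < n → fun h k ≡ fun h' k) →
              ∀ i → i < n → rangeChar h i ≡ rangeChar h' i
range-agree h h' n h≈h' h'≈h i i<n = true⇔true⇒≡ (transfer h h' h≈h') (transfer h' h h'≈h)
  where
  transfer : ∀ h h' → (∀ k → fun h k < n → fun h' k ≡ fun h k) →
             rangeChar h i ≡ true → rangeChar h' i ≡ true
  transfer h h' agree hit =
    let (k , hk≡i) = rangeChar-sound h hit
    in  rangeChar-complete h' (trans (agree k (subst (_< n) (sym hk≡i) i<n)) hk≡i)

-- Iterates of g and the g-orbit of a non-fixed point

iter : ℰ → ℕ → ℕ → ℕ
iter g k x = fold x (fun g) k

module _ (g : ℰ) where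

  x≤iter : ∀ k x → x ≤ iter g k x
  x≤iter zero    x = ≤-refl
  x≤iter (suc k) x = ≤-trans (x≤iter k x) (n≤fun g _)

  iter-mono-< : ∀ k {x y} → x < y → iter g k x < iter g k y
  iter-mono-< zero    x<y = x<y
  iter-mono-< (suc k) x<y = strict g _ _ (iter-mono-< k x<y)

  iter-+ : ∀ m n x → iter g m (iter g n x) ≡ iter g (m + n) x
  iter-+ m n x = sym (fold-+ x (fun g) m)

  iter-∸ : ∀ {n m} x → n ≤ m → iter g (m ∸ n) (iter g n x) ≡ iter g m x
  iter-∸ {n} {m} x n≤m = trans (iter-+ (m ∸ n) n x) (cong (λ k → iter g k x) (m∸n+n≡m n≤m))

  iter-fun : ∀ k x → iter g k (fun g x) ≡ iter g (suc k) x
  iter-fun zero    x = refl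
  iter-fun (suc k) x = cong (fun g) (iter-fun k x)

  iter-fixed : ∀ k {x} → fun g x ≡ x → iter g k x ≡ x
  iter-fixed zero    gx≡x = refl
  iter-fixed (suc k) gx≡x = trans (cong (fun g) (iter-fixed k gx≡x)) gx≡x

  <fun-upward : ∀ {b x} → b < fun g b → b ≤ x → x < fun g x
  <fun-upward {x = zero}  b<gb z≤n = b<gb
  <fun-upward {x = suc x} b<gb b≤1+x with m≤n⇒m<n∨m≡n b≤1+x
  ... | inj₁ (s≤s b≤x) = ≤-trans (s≤s (<fun-upward b<gb b≤x)) (strict g x (suc x) ≤-refl)
  ... | inj₂ refl      = b<gb

  orbit : ∀ {b} → b < fun g b → ℰ
  orbit {b} b<gb = fromSteps (λ k → iter g k b) (λ k → <fun-upward b<gb (x≤iter k b))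

  orbit-mono-≤ : ∀ {b} (b<gb : b < fun g b) {k k'} → k ≤ k' → iter g k b ≤ iter g k' b
  orbit-mono-≤ b<gb = fun-mono-≤ (orbit b<gb)

  orbitRange : ∀ {b} → b < fun g b → ℰ → InfSet
  orbitRange b<gb f = range (f ∘ℰ orbit b<gb)

  orbitRange-continuous : ∀ {b} (b<gb : b < fun g b) → Continuousℰ→Inf (orbitRange b<gb)
  orbitRange-continuous b<gb f n = n , λ f' f≈f' →
    range-agree (f ∘ℰ orbit b<gb) (f' ∘ℰ orbit b<gb) n
      (λ k fek<n → sym (f≈f' _ (≤-<-trans (n≤fun f _) fek<n)))
      (λ k f'ek<n → f≈f' _ (≤-<-trans (n≤fun f' _) f'ek<n))

  -- g ∘ orbit is orbit shifted by one, so composing with g drops the least element of the range.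
  orbitRange-∘g : ∀ {b} (b<gb : b < fun g b) f →
                  char (dropMin (orbitRange b<gb f)) ≗ char (orbitRange b<gb (f ∘ℰ g))
  orbitRange-∘g b<gb f = dropMin-range (f ∘ℰ orbit b<gb)

gBetter⇒better : ∀ {a ℓ} (A : Set a) (R : Rel A ℓ) (g : ℰ) {b} → b < fun g b →
                 GBetterRelation g A R → BetterRelation A R
gBetter⇒better A R g b<gb gBetter = gBetter ∘
  badInf⇒badℰ {R = R} g (orbitRange g b<gb) (orbitRange-continuous g b<gb) (orbitRange-∘g g b<gb)

-- Increasing enumeration of an infinite set

IsLeastFrom : (ℕ → Bool) → ℕ → ℕ → Set
IsLeastFrom X n r = n ≤ r × X r ≡ true × (∀ m → n ≤ m → m < r → X m ≡ false)

isLeastFrom-unique : ∀ {X n r r'} → IsLeastFrom X n r → IsLeastFrom X n r' → r ≡ r'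
isLeastFrom-unique {r = r} {r'} (n≤r , Xr , r-least) (n≤r' , Xr' , r'-least) with <-cmp r r'
... | tri< r<r' _ _ = contradiction (trans (sym Xr) (r'-least r n≤r r<r')) (λ ())
... | tri≈ _ r≡r' _ = r≡r'
... | tri> _ _ r'<r = contradiction (trans (sym Xr') (r-least r' n≤r' r'<r)) (λ ())

search : (ℕ → Bool) → ℕ → ℕ → ℕ
search X n zero    = n
search X n (suc k) = if X n then n else search X (suc n) k

search-isLeastFrom : ∀ X k n → X (k + n) ≡ true → IsLeastFrom X n (search X n k)
search-isLeastFrom X zero    n Xn = ≤-refl , Xn , λ m n≤m m<n → contradiction n≤m (<⇒≱ m<n)
search-isLeastFrom X (suc k) n Xk+n with X n in Xn
... | true  = ≤-refl , Xn , λ m n≤m m<n → contradiction n≤m (<⇒≱ m<n)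
... | false with search-isLeastFrom X k (suc n) (trans (cong X (+-suc k n)) Xk+n)
... | n<r , Xr , r-least = <⇒≤ n<r , Xr , least
  where
  least : ∀ m → n ≤ m → m < search X (suc n) k → X m ≡ false
  least m n≤m m<r with m≤n⇒m<n∨m≡n n≤m
  ... | inj₁ n<m  = r-least m n<m m<r
  ... | inj₂ refl = Xn

leastFrom : InfSet → ℕ → ℕ
leastFrom N n = search (char N) n (proj₁ (inf N n) ∸ n)

leastFrom-isLeastFrom : ∀ N n → IsLeastFrom (char N) n (leastFrom N n)
leastFrom-isLeastFrom N n =
  let (w , n≤w , Nw) = inf N n
  in  search-isLeastFrom (char N) (w ∸ n) n (trans (cong (char N) (m∸n+n≡m n≤w)) Nw)

leastFrom-agree : ∀ N Y n → (∀ m → n ≤ m → m ≤ leastFrom N n → char N m ≡ char Y m) →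
                  leastFrom Y n ≡ leastFrom N n
leastFrom-agree N Y n N≈Y =
  let (n≤r , Nr , r-least) = leastFrom-isLeastFrom N n
  in  isLeastFrom-unique (leastFrom-isLeastFrom Y n)
        ( n≤r , trans (sym (N≈Y _ n≤r ≤-refl)) Nr
        , λ m n≤m m<r → trans (sym (N≈Y m n≤m (<⇒≤ m<r))) (r-least m n≤m m<r))

leastFrom-skip : ∀ N {n n'} → n ≤ n' → (∀ m → n ≤ m → m < n' → char N m ≡ false) →
                 leastFrom N n ≡ leastFrom N n'
leastFrom-skip N {n} {n'} n≤n' gap with leastFrom-isLeastFrom N n'
... | n'≤r , Nr , r-least =
  isLeastFrom-unique (leastFrom-isLeastFrom N n) (≤-trans n≤n' n'≤r , Nr , least)
  where
  least : ∀ m → n ≤ m → m < leastFrom N n' → char N m ≡ false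
  least m n≤m m<r with m <? n'
  ... | yes m<n' = gap m n≤m m<n'
  ... | no  m≮n' = r-least m (≮⇒≥ m≮n') m<r

enum : InfSet → ℕ → ℕ
enum N zero    = leastFrom N zero
enum N (suc k) = leastFrom N (suc (enum N k))

enumℰ : InfSet → ℰ
enumℰ N = fromSteps (enum N) (λ k → proj₁ (leastFrom-isLeastFrom N (suc (enum N k))))

enum-agree : ∀ N Y m → (∀ i → i ≤ enum N m → char N i ≡ char Y i) →
             ∀ k → k ≤ m → enum Y k ≡ enum N k
enum-agree N Y m N≈Y zero    k≤m =
  leastFrom-agree N Y 0 (λ i _ i≤r → N≈Y i (≤-trans i≤r (fun-mono-≤ (enumℰ N) k≤m)))
enum-agree N Y m N≈Y (suc k) k≤m rewrite enum-agree N Y m N≈Y k (≤-trans (n≤1+n k) k≤m) =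
  leastFrom-agree N Y (suc (enum N k)) (λ i _ i≤r → N≈Y i (≤-trans i≤r (fun-mono-≤ (enumℰ N) k≤m)))

enumℰ-continuous : ContinuousInf→ℰ enumℰ
enumℰ-continuous N n = suc (enum N n) , λ Y N≈Y i i<n →
  sym (enum-agree N Y n (λ j j≤ → N≈Y j (s≤s j≤)) i (<⇒≤ i<n))

module _ (N : InfSet) where

  private
    min : ℕ
    min = leastFrom N 0

    min∈N : char N min ≡ true
    min∈N = proj₁ (proj₂ (leastFrom-isLeastFrom N 0))

    <min∉N : ∀ m → m < min → char N m ≡ false
    <min∉N m = proj₂ (proj₂ (leastFrom-isLeastFrom N 0)) m z≤n

  dropMin-≤min : ∀ {m} → m ≤ min → char (dropMin N) m ≡ false
  dropMin-≤min {m} m≤min with m≤n⇒m<n∨m≡n m≤min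
  ... | inj₁ m<min = cong (_∧ anyBefore (char N) m) (<min∉N m m<min)
  ... | inj₂ refl  = trans (cong (char N m ∧_) (anyBefore-false (char N) m <min∉N)) (∧-zeroʳ (char N m))

  dropMin->min : ∀ {m} → min < m → char (dropMin N) m ≡ char N m
  dropMin->min {m} min<m =
    trans (cong (char N m ∧_) (anyBefore-complete (char N) m min<m min∈N)) (∧-identityʳ (char N m))

  leastFrom-dropMin : ∀ {n} → min < n → leastFrom (dropMin N) n ≡ leastFrom N n
  leastFrom-dropMin {n} min<n =
    leastFrom-agree N (dropMin N) n (λ m n≤m _ → sym (dropMin->min (<-≤-trans min<n n≤m)))

  enum-dropMin : ∀ k → enum (dropMin N) k ≡ enum N (suc k)
  enum-dropMin zero = trans
    (leastFrom-skip (dropMin N) z≤n (λ m _ m<1+min → dropMin-≤min (≤-pred m<1+min)))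
    (leastFrom-dropMin ≤-refl)
  enum-dropMin (suc k) rewrite enum-dropMin k =
    leastFrom-dropMin (s≤s (fun-mono-≤ (enumℰ N) (z≤n {suc k})))

-- Blockwise iteration

∸-suc : ∀ {m n} → suc n ≤ m → m ∸ n ≡ suc (m ∸ suc n)
∸-suc {suc m} {zero}  _         = refl
∸-suc {suc m} {suc n} (s≤s n<m) = ∸-suc n<m

module Blocks (g : ℰ) {b : ℕ} (b<gb : b < fun g b) (fixed : ∀ p → p < b → fun g p ≡ p) where

  -- level p is the i with g^i b ≤ p < g^(i+1) b when b ≤ p, and 0 when p < b.
  level : ℕ → ℕ
  level zero = 0
  level (suc p) with iter g (suc (level p)) b ≟ suc p
  ... | yes _ = suc (level p)
  ... | no  _ = level p

  level-suc : ∀ p → level (suc p) ≡ level p ⊎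
                    (level (suc p) ≡ suc (level p) × iter g (suc (level p)) b ≡ suc p)
  level-suc p with iter g (suc (level p)) b ≟ suc p
  ... | yes hit = inj₂ (refl , hit)
  ... | no  _   = inj₁ refl

  level≤ : ∀ p → level p ≤ p
  level≤ zero = z≤n
  level≤ (suc p) with level-suc p
  ... | inj₁ same       rewrite same = m≤n⇒m≤1+n (level≤ p)
  ... | inj₂ (next , _) rewrite next = s≤s (level≤ p)

  LevelSpec : ℕ → Set
  LevelSpec p = p < iter g (suc (level p)) b × (p < b → level p ≡ 0) × (b ≤ p → iter g (level p) b ≤ p)

  level-spec : ∀ p → LevelSpec p
  level-spec zero = ≤-<-trans z≤n b<gb , (λ _ → refl) , (λ b≤0 → b≤0)
  level-spec (suc p) with level-spec p | iter g (suc (level p)) b ≟ suc p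
  ... | _ | yes hit =
        subst (_< iter g (suc (suc (level p))) b) hit (<fun-upward g b<gb (x≤iter g (suc (level p)) b))
      , (λ 1+p<b → contradiction (subst (b ≤_) hit (x≤iter g (suc (level p)) b)) (<⇒≱ 1+p<b))
      , (λ _ → ≤-reflexive hit)
  ... | p<next , below , above | no miss =
        ≤∧≢⇒< p<next (miss ∘ sym)
      , (λ 1+p<b → below (<-trans (n<1+n p) 1+p<b))
      , above′
    where
    above′ : b ≤ suc p → iter g (level p) b ≤ suc p
    above′ b≤1+p with m≤n⇒m<n∨m≡n b≤1+p
    ... | inj₁ b<1+p = m≤n⇒m≤1+n (above (≤-pred b<1+p))
    ... | inj₂ refl  rewrite below ≤-refl = b≤1+p

  level-unique : ∀ q i j → iter g i b ≤ q → q < iter g (suc i) b →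
                 iter g j b ≤ q → q < iter g (suc j) b → i ≡ j
  level-unique q i j i≤q q<i+1 j≤q q<j+1 with <-cmp i j
  ... | tri< i<j _ _ = contradiction (≤-trans (orbit-mono-≤ g b<gb i<j) j≤q) (<⇒≱ q<i+1)
  ... | tri≈ _ i≡j _ = i≡j
  ... | tri> _ _ j<i = contradiction (≤-trans (orbit-mono-≤ g b<gb j<i) i≤q) (<⇒≱ q<j+1)

  level-fun : ∀ {p} → b ≤ p → level (fun g p) ≡ suc (level p)
  level-fun {p} b≤p = level-unique (fun g p) _ _
    (proj₂ (proj₂ (level-spec (fun g p))) (≤-trans b≤p (n≤fun g p)))
    (proj₁ (level-spec (fun g p)))
    (fun-mono-≤ g (proj₂ (proj₂ (level-spec p)) b≤p))
    (strict g _ _ (proj₁ (level-spec p)))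

  -- i ≤ fun e i, so the subtraction does not truncate.
  blockwiseFun : ℰ → ℕ → ℕ
  blockwiseFun e p = iter g (fun e (level p) ∸ level p) p

  blockwiseFun-step : ∀ e p → blockwiseFun e p < blockwiseFun e (suc p)
  blockwiseFun-step e p with level-suc p
  ... | inj₁ same rewrite same = iter-mono-< g (fun e (level p) ∸ level p) (n<1+n p)
  ... | inj₂ (next , hit) rewrite next = begin-strict
    iter g (fun e i ∸ i) p                             <⟨ iter-mono-< g (fun e i ∸ i) (n<1+n p) ⟩
    iter g (fun e i ∸ i) (suc p)                       ≡⟨ cong (iter g (fun e i ∸ i)) (sym hit) ⟩
    iter g (suc (fun e i) ∸ suc i) (iter g (suc i) b)  ≡⟨ iter-∸ g b (s≤s (n≤fun e i)) ⟩
    iter g (suc (fun e i)) b                           ≤⟨ orbit-mono-≤ g b<gb (strict e i (suc i) ≤-refl) ⟩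
    iter g (fun e (suc i)) b                           ≡⟨ sym (iter-∸ g b (n≤fun e (suc i))) ⟩
    iter g (fun e (suc i) ∸ suc i) (iter g (suc i) b)  ≡⟨ cong (iter g (fun e (suc i) ∸ suc i)) hit ⟩
    iter g (fun e (suc i) ∸ suc i) (suc p)             ∎
    where
    open ≤-Reasoning hiding (strict)
    i = level p

  blockwise : ℰ → ℰ
  blockwise e = fromSteps (blockwiseFun e) (blockwiseFun-step e)

  blockwise-shift : ∀ e → fun (blockwise (shiftℰ e)) ≗ fun (blockwise e ∘ℰ g)
  blockwise-shift e p with b ≤? p
  ... | no b≰p = let gp≡p = fixed p (≰⇒> b≰p) in
    trans (iter-fixed g (fun e (suc (level p)) ∸ level p) gp≡p)
          (sym (trans (cong (blockwiseFun e) gp≡p) (iter-fixed g (fun e (level p) ∸ level p) gp≡p)))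
  ... | yes b≤p rewrite level-fun b≤p = let i = level p in begin
    iter g (fun e (suc i) ∸ i) p             ≡⟨ cong (λ k → iter g k p) (∸-suc (n≤fun e (suc i))) ⟩
    iter g (suc (fun e (suc i) ∸ suc i)) p   ≡⟨ sym (iter-fun g (fun e (suc i) ∸ suc i) p) ⟩
    iter g (fun e (suc i) ∸ suc i) (fun g p) ∎
    where open ≡-Reasoning

  blockwise-agree : ∀ e e' m → (∀ i → i < m → fun e i ≡ fun e' i) →
                    ∀ p → p < m → fun (blockwise e) p ≡ fun (blockwise e') p
  blockwise-agree e e' m e≈e' p p<m =
    cong (λ k → iter g (k ∸ level p) p) (e≈e' (level p) (≤-<-trans (level≤ p) p<m))

  enumBlockwise : InfSet → ℰ
  enumBlockwise = blockwise ∘ enumℰ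

  enumBlockwise-continuous : ContinuousInf→ℰ enumBlockwise
  enumBlockwise-continuous N n =
    let (m , enum-agree) = enumℰ-continuous N n
    in  m , λ Y N≈Y → blockwise-agree (enumℰ N) (enumℰ Y) n (enum-agree Y N≈Y)

  enumBlockwise-∘g : ∀ N → fun (enumBlockwise N ∘ℰ g) ≗ fun (enumBlockwise (dropMin N))
  enumBlockwise-∘g N p = trans (sym (blockwise-shift (enumℰ N) p))
    (blockwise-agree (shiftℰ (enumℰ N)) (enumℰ (dropMin N)) (suc p) (λ i _ → sym (enum-dropMin N i)) p ≤-refl)

better⇒gBetter : ∀ {a ℓ} (A : Set a) (R : Rel A ℓ) (g : ℰ) {b} → b < fun g b →
                 (∀ p → p < b → fun g p ≡ p) → BetterRelation A R → GBetterRelation g A R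
better⇒gBetter A R g b<gb fixed better =
  better ∘ badℰ⇒badInf {R = R} g enumBlockwise enumBlockwise-continuous enumBlockwise-∘g
  where open Blocks g b<gb fixed

moved⇒< : (g : ℰ) → ∀ {b} → fun g b ≢ b → b < fun g b
moved⇒< g {b} gb≢b = ≤∧≢⇒< (n≤fun g b) (gb≢b ∘ sym)

leastMoved : (g : ℰ) → ∀ {m} → fun g m ≢ m → ∃[ b ] b < fun g b × (∀ p → p < b → fun g p ≡ p)
leastMoved g {zero}  g0≢0 = 0 , moved⇒< g g0≢0 , λ _ ()
leastMoved g {suc m} gm≢m with fun g m ≟ m
... | no  gm≢m′ = leastMoved g gm≢m′
... | yes gm≡m  = suc m , moved⇒< g gm≢m , fixed
  where
  fixed : ∀ p → p < suc m → fun g p ≡ p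
  fixed p p≤m with fun g p ≟ p
  ... | yes gp≡p = gp≡p
  ... | no  gp≢p = contradiction (sym gm≡m) (<⇒≢ (<fun-upward g (moved⇒< g gp≢p) (≤-pred p≤m)))

-- ¬ IsId g provides no moved point constructively, but it suffices when the goal is a negation.
¬IsId⇒¬¬moved : (g : ℰ) → ¬ IsId g → ¬ ¬ (∃[ m ] fun g m ≢ m)
¬IsId⇒¬¬moved g g≢id none = g≢id (λ n → decidable-stable (fun g n ≟ n) (λ gn≢n → none (n , gn≢n)))

theorem4p11 : {a ℓ : Level} (g : ℰ) → ¬ IsId g →
    ((A : Set a) (R : Rel A ℓ) → GBetterRelation g A R ⇔ BetterRelation A R)
    × ((Q : Set a) (_≤_ : Rel Q ℓ) → IsPreorder _≡_ _≤_ → GBqo g Q _≤_ ⇔ Bqo Q _≤_)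
theorem4p11 g g≢id = gBetter⇔better , λ Q _≤_ _ → gBetter⇔better Q _≤_
  where
  gBetter⇔better : ∀ {a ℓ} (A : Set a) (R : Rel A ℓ) → GBetterRelation g A R ⇔ BetterRelation A R
  gBetter⇔better A R = mk⇔
    (λ gBetter bad → ¬IsId⇒¬¬moved g g≢id λ (_ , gm≢m) →
      let (_ , b<gb , _) = leastMoved g gm≢m in gBetter⇒better A R g b<gb gBetter bad)
    (λ better bad → ¬IsId⇒¬¬moved g g≢id λ (_ , gm≢m) →
      let (_ , b<gb , fixed) = leastMoved g gm≢m in better⇒gBetter A R g b<gb fixed better bad)
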